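{- Let $T$ be a tree of order $n\ge 4$ with $\mathrm{diam}(T)=3$. Then $\gamma_{tc}(M(T))=2n-4$.
   Context: All graphs are finite, simple and undirected; $\mathrm{diam}(T)$ is the diameter of $T$. For a graph $H$, a set $D\subseteq V(H)$ is a total dominating set if every vertex of $H$ has a neighbor in $D$. A set $D\subseteq V(H)$ is a total outer-connected dominating set of $H$ if $D$ is a total dominating set and the induced subgraph $H[V(H)\setminus D]$ is connected; $\gamma_{tc}(H)$ denotes the minimum cardinality of a total outer-connected dominating set of $H$. The middle graph $M(G)$ of a graph $G$ has vertex set $V(G)\cup E(G)$, where two elements $x,y$ are adjacent iff either $x,y\in E(G)$ are edges of $G$ sharing an endpoint, or one of them is a vertex of $G$ and the other is an edge of $G$ incident to it. -}

module Defs where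

open import Data.Nat using (ℕ; zero; suc; _≤_; _<_)
open import Data.Fin as Fin using (Fin)
open import Data.Bool using (Bool; true)
open import Data.Empty using (⊥)
open import Data.Unit using (⊤)
open import Data.Sum using (_⊎_; inj₁; inj₂)
open import Data.Product using (Σ; ∃; _×_; _,_; proj₁; proj₂)
open import Data.List using (List; []; _∷_; _++_; [_]; length)
open import Data.List.Membership.Propositional using (_∈_)
open import Data.List.Relation.Unary.Unique.Propositional using (Unique)
open import Data.List.Relation.Unary.Linked using (Linked)
open import Relation.Nullary using (¬_)
open import Relation.Binary.PropositionalEquality as Eq using (_≡_; _≢_; refl)

record Graph : Set₁ where
  field
    V      : Set
    Adj    : V → V → Set
    sym    : ∀ {u v} → Adj u v → Adj v u
    irrefl : ∀ {u} → ¬ Adj u u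
open Graph public

data Walk (G : Graph) (P : V G → Set) : V G → V G → ℕ → Set where
  here : ∀ {u} → P u → Walk G P u u zero
  step : ∀ {u w v k} → P u → Adj G u w → Walk G P w v k → Walk G P u v (suc k)

Everything : {A : Set} → A → Set
Everything _ = ⊤

Connected : Graph → Set
Connected G = ∀ u v → ∃ λ k → Walk G Everything u v k

record Cycle (G : Graph) : Set where
  field
    x        : V G
    xs       : List (V G)
    long     : 2 ≤ length xs
    distinct : Unique (x ∷ xs)
    closed   : Linked (Adj G) (x ∷ xs ++ [ x ])

Tree : Graph → Set
Tree G = Connected G × ¬ Cycle G

Dist : (G : Graph) → V G → V G → ℕ → Set
Dist G u v d = Walk G Everything u v d × (∀ k → k < d → ¬ Walk G Everything u v k)

Diam : Graph → ℕ → Set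
Diam G d = (∀ u v → ∃ λ e → e ≤ d × Dist G u v e) × (∃ λ u → ∃ λ v → Dist G u v d)

record FinGraph (n : ℕ) : Set where
  field
    adj    : Fin n → Fin n → Bool
    sym    : ∀ u v → adj u v ≡ adj v u
    irrefl : ∀ u → adj u u ≡ true → ⊥
open FinGraph public

toGraph : ∀ {n} → FinGraph n → Graph
toGraph {n} G = record
  { V = Fin n
  ; Adj = λ u v → adj G u v ≡ true
  ; sym = λ {u} {v} e → Eq.trans (FinGraph.sym G v u) e
  ; irrefl = λ {u} e → irrefl G u e
  }

Edge : ∀ {n} → FinGraph n → Set
Edge {n} G = Σ (Fin n) λ u → Σ (Fin n) λ v → (u Fin.< v) × (adj G u v ≡ true)

end₁ end₂ : ∀ {n} {G : FinGraph n} → Edge G → Fin n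
end₁ e = proj₁ e
end₂ e = proj₁ (proj₂ e)

Incident : ∀ {n} {G : FinGraph n} → Fin n → Edge G → Set
Incident {G = G} x e = (x ≡ end₁ {G = G} e) ⊎ (x ≡ end₂ {G = G} e)

ShareEnd : ∀ {n} {G : FinGraph n} → Edge G → Edge G → Set
ShareEnd {n} {G = G} e f = ∃ λ (x : Fin n) → Incident {G = G} x e × Incident {G = G} x f

MAdj : ∀ {n} (G : FinGraph n) → (Fin n ⊎ Edge G) → (Fin n ⊎ Edge G) → Set
MAdj G (inj₁ x) (inj₁ y) = ⊥
MAdj G (inj₁ x) (inj₂ e) = Incident {G = G} x e
MAdj G (inj₂ e) (inj₁ x) = Incident {G = G} x e
MAdj G (inj₂ e) (inj₂ f) = (e ≢ f) × ShareEnd {G = G} e f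

Middle : ∀ {n} → FinGraph n → Graph
Middle G = record
  { V = Fin _ ⊎ Edge G
  ; Adj = MAdj G
  ; sym = λ {u} {v} → msym u v
  ; irrefl = λ {u} → mirr u
  }
  where
  msym : ∀ u v → MAdj G u v → MAdj G v u
  msym (inj₁ x) (inj₁ y) ()
  msym (inj₁ x) (inj₂ e) p = p
  msym (inj₂ e) (inj₁ x) p = p
  msym (inj₂ e) (inj₂ f) (ne , x , a , b) = (λ q → ne (Eq.sym q)) , x , b , a
  mirr : ∀ u → ¬ MAdj G u u
  mirr (inj₁ x) ()
  mirr (inj₂ e) (ne , _) = ne refl

TotalDominating : (H : Graph) → List (V H) → Set
TotalDominating H D = ∀ v → ∃ λ u → u ∈ D × Adj H v u

OuterConnected : (H : Graph) → List (V H) → Set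
OuterConnected H D = ∀ u v → ¬ u ∈ D → ¬ v ∈ D → ∃ λ k → Walk H (λ w → ¬ w ∈ D) u v k

IsTOCDS : (H : Graph) → List (V H) → Set
IsTOCDS H D = Unique D × TotalDominating H D × OuterConnected H D

γtc≡ : Graph → ℕ → Set
γtc≡ H m = (∃ λ D → IsTOCDS H D × length D ≡ m) × (∀ D → IsTOCDS H D → m ≤ length D)

-- A tree of diameter 3 is a double star: the inner vertices c₁, c₂ of a diametral
-- path a c₁ c₂ b are adjacent and every other vertex is a leaf hanging from exactly
-- one of them, because a non-backtracking walk of length 4 together with a walk of
-- length ≤ 3 between its ends would close a cycle of length ≤ 7.
-- In M(T) the only neighbour of a leaf x is its pendant edge, so a total dominating
-- set D contains all n − 2 pendant edges. If D misses the vertex of some leaf, that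
-- vertex is isolated in M(T) − D, so D is everything else; otherwise D contains all
-- leaves as well. Either way |D| ≥ 2n − 4, and the leaves with their pendant edges
-- attain this, their complement being the path c₁, c₁c₂, c₂.

module Submission where

open import Defs hiding (sym; irrefl)
open import Axiom.UniquenessOfIdentityProofs using (module Decidable⇒UIP)
open import Data.Bool using (true)
import Data.Bool.Properties as Bool
open import Data.Empty using (⊥; ⊥-elim)
open import Data.Fin using (Fin)
open import Data.Fin.Properties using (_≟_; <-cmp; <-asym; <-irrelevant)
open import Data.List using (List; []; _∷_; _++_; length; map; filter; allFin)
open import Data.List.Membership.Propositional using (_∈_; _∉_; _─_; find)
open import Data.List.Membership.Propositional.Properties
  using (∈-filter⁺; ∈-filter⁻; ∈-map⁺; ∈-map⁻; ∈-++⁺ˡ; ∈-++⁺ʳ; ∈-++⁻; ∈-allFin)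
import Data.List.Membership.DecPropositional as DecMembership
open import Data.List.Properties using (length-++; length-map; length-tabulate; length-removeAt′)
open import Data.List.Relation.Binary.Subset.Propositional using (_⊆_)
open import Data.List.Relation.Unary.All as All using (All; []; _∷_; all?)
import Data.List.Relation.Unary.All.Properties as All
open import Data.List.Relation.Unary.AllPairs using ([]; _∷_)
open import Data.List.Relation.Unary.Any using (here; there; index)
open import Data.List.Relation.Unary.Linked using ([-]; _∷_)
open import Data.List.Relation.Unary.Unique.Propositional using (Unique)
import Data.List.Relation.Unary.Unique.Propositional.Properties as Unique
open import Data.Nat using (ℕ; suc; _≤_; _<_; _+_; _*_; _∸_; z≤n; s≤s)
open import Data.Nat.Properties using (≤-antisym; ≤-pred; +-identityʳ; +-suc; module ≤-Reasoning)
open import Data.Product using (∃; _×_; _,_; proj₁; proj₂)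
open import Data.Sum using (_⊎_; inj₁; inj₂)
open import Data.Sum.Properties as Sum using (inj₁-injective; inj₂-injective)
open import Data.Unit using (tt)
open import Relation.Binary.Definitions using (DecidableEquality; tri<; tri≈; tri>)
open import Relation.Binary.PropositionalEquality
  using (_≡_; _≢_; refl; sym; trans; cong; cong₂; subst; ≢-sym; module ≡-Reasoning)
open import Relation.Nullary using (¬_; Dec; yes; no; ¬?; _×-dec_)

module _ {A : Set} where

  ∈-─⁺ : ∀ {x y} {xs : List A} (x∈xs : x ∈ xs) → y ∈ xs → y ≢ x → y ∈ xs ─ x∈xs
  ∈-─⁺ (here refl) (here refl) y≢x = ⊥-elim (y≢x refl)
  ∈-─⁺ (here refl) (there y∈xs) _ = y∈xs
  ∈-─⁺ (there x∈xs) (here refl) _ = here refl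
  ∈-─⁺ (there x∈xs) (there y∈xs) y≢x = there (∈-─⁺ x∈xs y∈xs y≢x)

  Unique⇒length-mono-⊆ : ∀ {xs ys : List A} → Unique xs → xs ⊆ ys → length xs ≤ length ys
  Unique⇒length-mono-⊆ [] _ = z≤n
  Unique⇒length-mono-⊆ {x ∷ xs} {ys} (x∉xs ∷ xs!) xs⊆ys = begin
    suc (length xs)          ≤⟨ s≤s (Unique⇒length-mono-⊆ xs! xs⊆ys─x) ⟩
    suc (length (ys ─ x∈ys)) ≡⟨ sym (length-removeAt′ ys (index x∈ys)) ⟩
    length ys                ∎
    where
    open ≤-Reasoning
    x∈ys = xs⊆ys (here refl)
    xs⊆ys─x : xs ⊆ ys ─ x∈ys
    xs⊆ys─x y∈xs = ∈-─⁺ x∈ys (xs⊆ys (there y∈xs)) (λ y≡x → All.lookup x∉xs y∈xs (sym y≡x))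

  Unique-map⁺-injectiveOn : ∀ {B : Set} {f : A → B} {xs} → Unique xs →
    (∀ {x y} → x ∈ xs → y ∈ xs → f x ≡ f y → x ≡ y) → Unique (map f xs)
  Unique-map⁺-injectiveOn [] _ = []
  Unique-map⁺-injectiveOn (x∉xs ∷ xs!) inj =
    All.map⁺ (All.tabulate λ y∈xs fx≡fy → All.lookup x∉xs y∈xs (inj (here refl) (there y∈xs) fx≡fy))
    ∷ Unique-map⁺-injectiveOn xs! (λ x∈ y∈ → inj (there x∈) (there y∈))

walk-++ : ∀ {G P u v w k l} → Walk G P u v k → Walk G P v w l → Walk G P u w (k + l)
walk-++ (here _) q = q
walk-++ (step Pu u~ p) q = step Pu u~ (walk-++ p q)

walk-head : ∀ {G P u v k} → Walk G P u v k → P u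
walk-head (here Pu) = Pu
walk-head (step Pu _ _) = Pu

2ℓ≡2*[2+ℓ]∸4 : ∀ ℓ → ℓ + ℓ ≡ 2 * suc (suc ℓ) ∸ 4
2ℓ≡2*[2+ℓ]∸4 ℓ rewrite +-identityʳ ℓ | +-suc ℓ (suc ℓ) | +-suc ℓ ℓ = refl

module _ {n : ℕ} (T : FinGraph n) where

  infix 4 _~_ _~?_

  _~_ : Fin n → Fin n → Set
  u ~ v = adj T u v ≡ true

  _~?_ : ∀ u v → Dec (u ~ v)
  u ~? v = adj T u v Bool.≟ true

  ~-sym : ∀ {u v} → u ~ v → v ~ u
  ~-sym = Graph.sym (toGraph T)

  ~⇒≢ : ∀ {u v} → u ~ v → u ≢ v
  ~⇒≢ {u} u~u refl = FinGraph.irrefl T u u~u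

  ≁-sym : ∀ {u v} → ¬ u ~ v → ¬ v ~ u
  ≁-sym u≁v v~u = u≁v (~-sym v~u)

  ~-≁⇒≢ : ∀ {u v w} → u ~ w → ¬ v ~ w → u ≢ v
  ~-≁⇒≢ u~w v≁w refl = v≁w u~w

  ≁-~⇒≢ : ∀ {u v w} → ¬ u ~ w → v ~ w → u ≢ v
  ≁-~⇒≢ u≁w v~w = ≢-sym (~-≁⇒≢ v~w u≁w)

  E : Set
  E = Edge T

  Inc : Fin n → E → Set
  Inc = Incident {G = T}

  end₁~end₂ : ∀ e → end₁ {G = T} e ~ end₂ {G = T} e
  end₁~end₂ (_ , _ , _ , u~v) = u~v

  Edge-≡ : ∀ {e f : E} → end₁ {G = T} e ≡ end₁ {G = T} f → end₂ {G = T} e ≡ end₂ {G = T} f → e ≡ f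
  Edge-≡ {u , v , u<v , u~v} {.u , .v , u<v′ , u~v′} refl refl
    rewrite <-irrelevant u<v u<v′ | Decidable⇒UIP.≡-irrelevant Bool._≟_ u~v u~v′ = refl

  _≟E_ : DecidableEquality E
  e ≟E f with end₁ {G = T} e ≟ end₁ {G = T} f | end₂ {G = T} e ≟ end₂ {G = T} f
  ... | yes p | yes q = yes (Edge-≡ p q)
  ... | no ¬p | _ = no (λ e≡f → ¬p (cong (end₁ {G = T}) e≡f))
  ... | _ | no ¬q = no (λ e≡f → ¬q (cong (end₂ {G = T}) e≡f))

  private
    Joins : Fin n → Fin n → E → Set
    Joins u v e = (u ≡ end₁ {G = T} e × v ≡ end₂ {G = T} e) ⊎ (u ≡ end₂ {G = T} e × v ≡ end₁ {G = T} e)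

    incident⇒joins : ∀ {u v} e → u ≢ v → Inc u e → Inc v e → Joins u v e
    incident⇒joins e u≢v (inj₁ p) (inj₁ q) = ⊥-elim (u≢v (trans p (sym q)))
    incident⇒joins e u≢v (inj₁ p) (inj₂ q) = inj₁ (p , q)
    incident⇒joins e u≢v (inj₂ p) (inj₁ q) = inj₂ (p , q)
    incident⇒joins e u≢v (inj₂ p) (inj₂ q) = ⊥-elim (u≢v (trans p (sym q)))

    joins-unique : ∀ {u v} e f → Joins u v e → Joins u v f → e ≡ f
    joins-unique e f (inj₁ (p , q)) (inj₁ (r , s)) = Edge-≡ (trans (sym p) r) (trans (sym q) s)
    joins-unique e f (inj₂ (p , q)) (inj₂ (r , s)) = Edge-≡ (trans (sym q) s) (trans (sym p) r)
    joins-unique (_ , _ , e₁<e₂ , _) (_ , _ , f₁<f₂ , _) (inj₁ (refl , refl)) (inj₂ (refl , refl)) =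
      ⊥-elim (<-asym e₁<e₂ f₁<f₂)
    joins-unique (_ , _ , e₁<e₂ , _) (_ , _ , f₁<f₂ , _) (inj₂ (refl , refl)) (inj₁ (refl , refl)) =
      ⊥-elim (<-asym e₁<e₂ f₁<f₂)

  edge-unique : ∀ {u v} e f → u ≢ v → Inc u e → Inc v e → Inc u f → Inc v f → e ≡ f
  edge-unique e f u≢v ue ve uf vf =
    joins-unique e f (incident⇒joins e u≢v ue ve) (incident⇒joins f u≢v uf vf)

  incident-ends : ∀ {u v z} e → u ≢ v → Inc u e → Inc v e → Inc z e → z ≡ u ⊎ z ≡ v
  incident-ends e u≢v ue ve (inj₁ z≡e₁) with incident⇒joins e u≢v ue ve
  ... | inj₁ (u≡e₁ , _) = inj₁ (trans z≡e₁ (sym u≡e₁))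
  ... | inj₂ (_ , v≡e₁) = inj₂ (trans z≡e₁ (sym v≡e₁))
  incident-ends e u≢v ue ve (inj₂ z≡e₂) with incident⇒joins e u≢v ue ve
  ... | inj₁ (_ , v≡e₂) = inj₂ (trans z≡e₂ (sym v≡e₂))
  ... | inj₂ (u≡e₂ , _) = inj₁ (trans z≡e₂ (sym u≡e₂))

  other-end : ∀ {u} e → Inc u e → ∃ λ v → u ~ v × Inc v e
  other-end e (inj₁ refl) = end₂ {G = T} e , end₁~end₂ e , inj₂ refl
  other-end e (inj₂ refl) = end₁ {G = T} e , ~-sym (end₁~end₂ e) , inj₁ refl

  edge : ∀ u v → u ~ v → E
  edge u v u~v with <-cmp u v
  ... | tri< u<v _ _ = u , v , u<v , u~v
  ... | tri≈ _ u≡v _ = ⊥-elim (~⇒≢ u~v u≡v)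
  ... | tri> _ _ v<u = v , u , v<u , ~-sym u~v

  edge-incident : ∀ u v (u~v : u ~ v) → Inc u (edge u v u~v) × Inc v (edge u v u~v)
  edge-incident u v u~v with <-cmp u v
  ... | tri< _ _ _ = inj₁ refl , inj₂ refl
  ... | tri≈ _ u≡v _ = ⊥-elim (~⇒≢ u~v u≡v)
  ... | tri> _ _ _ = inj₂ refl , inj₁ refl

  record InducedPath₅ (v₀ v₁ v₂ v₃ v₄ : Fin n) : Set where
    field
      v₀~v₁ : v₀ ~ v₁
      v₁~v₂ : v₁ ~ v₂
      v₂~v₃ : v₂ ~ v₃
      v₃~v₄ : v₃ ~ v₄
      v₀≁v₂ : ¬ v₀ ~ v₂
      v₀≁v₃ : ¬ v₀ ~ v₃
      v₀≁v₄ : ¬ v₀ ~ v₄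
      v₁≁v₃ : ¬ v₁ ~ v₃
      v₁≁v₄ : ¬ v₁ ~ v₄
      v₂≁v₄ : ¬ v₂ ~ v₄

  module Forest (acyclic : ¬ Cycle (toGraph T)) where

    no-triangle : ∀ {v₀ v₁ v₂} → v₀ ~ v₁ → v₁ ~ v₂ → v₂ ~ v₀ → ⊥
    no-triangle {v₀} p₀₁ p₁₂ p₂₀ = acyclic record
      { x = v₀ ; xs = _ ∷ _ ∷ [] ; long = s≤s (s≤s z≤n)
      ; distinct = (~⇒≢ p₀₁ ∷ ≢-sym (~⇒≢ p₂₀) ∷ []) ∷ (~⇒≢ p₁₂ ∷ []) ∷ [] ∷ []
      ; closed = p₀₁ ∷ p₁₂ ∷ p₂₀ ∷ [-] }

    no-4-cycle : ∀ {v₀ v₁ v₂ v₃} → v₀ ~ v₁ → v₁ ~ v₂ → v₂ ~ v₃ → v₃ ~ v₀ →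
      v₀ ≢ v₂ → v₁ ≢ v₃ → ⊥
    no-4-cycle {v₀} p₀₁ p₁₂ p₂₃ p₃₀ d₀₂ d₁₃ = acyclic record
      { x = v₀ ; xs = _ ∷ _ ∷ _ ∷ [] ; long = s≤s (s≤s z≤n)
      ; distinct = (~⇒≢ p₀₁ ∷ d₀₂ ∷ ≢-sym (~⇒≢ p₃₀) ∷ []) ∷ (~⇒≢ p₁₂ ∷ d₁₃ ∷ [])
                   ∷ (~⇒≢ p₂₃ ∷ []) ∷ [] ∷ []
      ; closed = p₀₁ ∷ p₁₂ ∷ p₂₃ ∷ p₃₀ ∷ [-] }

    no-5-cycle : ∀ {v₀ v₁ v₂ v₃ v₄} → v₀ ~ v₁ → v₁ ~ v₂ → v₂ ~ v₃ → v₃ ~ v₄ → v₄ ~ v₀ →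
      v₀ ≢ v₂ → v₀ ≢ v₃ → v₁ ≢ v₃ → v₁ ≢ v₄ → v₂ ≢ v₄ → ⊥
    no-5-cycle {v₀} p₀₁ p₁₂ p₂₃ p₃₄ p₄₀ d₀₂ d₀₃ d₁₃ d₁₄ d₂₄ = acyclic record
      { x = v₀ ; xs = _ ∷ _ ∷ _ ∷ _ ∷ [] ; long = s≤s (s≤s z≤n)
      ; distinct = (~⇒≢ p₀₁ ∷ d₀₂ ∷ d₀₃ ∷ ≢-sym (~⇒≢ p₄₀) ∷ []) ∷ (~⇒≢ p₁₂ ∷ d₁₃ ∷ d₁₄ ∷ [])
                   ∷ (~⇒≢ p₂₃ ∷ d₂₄ ∷ []) ∷ (~⇒≢ p₃₄ ∷ []) ∷ [] ∷ []
      ; closed = p₀₁ ∷ p₁₂ ∷ p₂₃ ∷ p₃₄ ∷ p₄₀ ∷ [-] }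

    no-6-cycle : ∀ {v₀ v₁ v₂ v₃ v₄ v₅} →
      v₀ ~ v₁ → v₁ ~ v₂ → v₂ ~ v₃ → v₃ ~ v₄ → v₄ ~ v₅ → v₅ ~ v₀ →
      v₀ ≢ v₂ → v₀ ≢ v₃ → v₀ ≢ v₄ → v₁ ≢ v₃ → v₁ ≢ v₄ → v₁ ≢ v₅ → v₂ ≢ v₄ → v₂ ≢ v₅ → v₃ ≢ v₅ → ⊥
    no-6-cycle {v₀} p₀₁ p₁₂ p₂₃ p₃₄ p₄₅ p₅₀ d₀₂ d₀₃ d₀₄ d₁₃ d₁₄ d₁₅ d₂₄ d₂₅ d₃₅ = acyclic record
      { x = v₀ ; xs = _ ∷ _ ∷ _ ∷ _ ∷ _ ∷ [] ; long = s≤s (s≤s z≤n)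
      ; distinct = (~⇒≢ p₀₁ ∷ d₀₂ ∷ d₀₃ ∷ d₀₄ ∷ ≢-sym (~⇒≢ p₅₀) ∷ []) ∷ (~⇒≢ p₁₂ ∷ d₁₃ ∷ d₁₄ ∷ d₁₅ ∷ [])
                   ∷ (~⇒≢ p₂₃ ∷ d₂₄ ∷ d₂₅ ∷ []) ∷ (~⇒≢ p₃₄ ∷ d₃₅ ∷ []) ∷ (~⇒≢ p₄₅ ∷ []) ∷ [] ∷ []
      ; closed = p₀₁ ∷ p₁₂ ∷ p₂₃ ∷ p₃₄ ∷ p₄₅ ∷ p₅₀ ∷ [-] }

    no-7-cycle : ∀ {v₀ v₁ v₂ v₃ v₄ v₅ v₆} →
      v₀ ~ v₁ → v₁ ~ v₂ → v₂ ~ v₃ → v₃ ~ v₄ → v₄ ~ v₅ → v₅ ~ v₆ → v₆ ~ v₀ →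
      v₀ ≢ v₂ → v₀ ≢ v₃ → v₀ ≢ v₄ → v₀ ≢ v₅ → v₁ ≢ v₃ → v₁ ≢ v₄ → v₁ ≢ v₅ → v₁ ≢ v₆ →
      v₂ ≢ v₄ → v₂ ≢ v₅ → v₂ ≢ v₆ → v₃ ≢ v₅ → v₃ ≢ v₆ → v₄ ≢ v₆ → ⊥
    no-7-cycle {v₀} p₀₁ p₁₂ p₂₃ p₃₄ p₄₅ p₅₆ p₆₀
               d₀₂ d₀₃ d₀₄ d₀₅ d₁₃ d₁₄ d₁₅ d₁₆ d₂₄ d₂₅ d₂₆ d₃₅ d₃₆ d₄₆ = acyclic record
      { x = v₀ ; xs = _ ∷ _ ∷ _ ∷ _ ∷ _ ∷ _ ∷ [] ; long = s≤s (s≤s z≤n)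
      ; distinct = (~⇒≢ p₀₁ ∷ d₀₂ ∷ d₀₃ ∷ d₀₄ ∷ d₀₅ ∷ ≢-sym (~⇒≢ p₆₀) ∷ [])
                   ∷ (~⇒≢ p₁₂ ∷ d₁₃ ∷ d₁₄ ∷ d₁₅ ∷ d₁₆ ∷ []) ∷ (~⇒≢ p₂₃ ∷ d₂₄ ∷ d₂₅ ∷ d₂₆ ∷ [])
                   ∷ (~⇒≢ p₃₄ ∷ d₃₅ ∷ d₃₆ ∷ []) ∷ (~⇒≢ p₄₅ ∷ d₄₆ ∷ []) ∷ (~⇒≢ p₅₆ ∷ []) ∷ [] ∷ []
      ; closed = p₀₁ ∷ p₁₂ ∷ p₂₃ ∷ p₃₄ ∷ p₄₅ ∷ p₅₆ ∷ p₆₀ ∷ [-] }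

    nonBacktracking⇒InducedPath₅ : ∀ {v₀ v₁ v₂ v₃ v₄} → v₀ ~ v₁ → v₁ ~ v₂ → v₂ ~ v₃ → v₃ ~ v₄ →
      v₀ ≢ v₂ → v₁ ≢ v₃ → v₂ ≢ v₄ → InducedPath₅ v₀ v₁ v₂ v₃ v₄
    nonBacktracking⇒InducedPath₅ {v₀} {v₁} {v₂} {v₃} {v₄} p₀₁ p₁₂ p₂₃ p₃₄ d₀₂ d₁₃ d₂₄ = record
      { v₀~v₁ = p₀₁ ; v₁~v₂ = p₁₂ ; v₂~v₃ = p₂₃ ; v₃~v₄ = p₃₄
      ; v₀≁v₂ = n₀₂ ; v₀≁v₃ = n₀₃ ; v₀≁v₄ = n₀₄ ; v₁≁v₃ = n₁₃ ; v₁≁v₄ = n₁₄ ; v₂≁v₄ = n₂₄ }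
      where
      n₀₂ : ¬ v₀ ~ v₂
      n₀₂ p₀₂ = no-triangle p₀₁ p₁₂ (~-sym p₀₂)
      n₁₃ : ¬ v₁ ~ v₃
      n₁₃ p₁₃ = no-triangle p₁₂ p₂₃ (~-sym p₁₃)
      n₂₄ : ¬ v₂ ~ v₄
      n₂₄ p₂₄ = no-triangle p₂₃ p₃₄ (~-sym p₂₄)
      n₀₃ : ¬ v₀ ~ v₃
      n₀₃ p₀₃ = no-4-cycle p₀₁ p₁₂ p₂₃ (~-sym p₀₃) d₀₂ d₁₃
      n₁₄ : ¬ v₁ ~ v₄
      n₁₄ p₁₄ = no-4-cycle p₁₂ p₂₃ p₃₄ (~-sym p₁₄) d₁₃ d₂₄
      n₀₄ : ¬ v₀ ~ v₄
      n₀₄ p₀₄ = no-5-cycle p₀₁ p₁₂ p₂₃ p₃₄ (~-sym p₀₄)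
        d₀₂ (~-≁⇒≢ p₀₁ (≁-sym n₁₃)) d₁₃ (≁-~⇒≢ n₁₃ (~-sym p₃₄)) d₂₄

    InducedPath₅-far : ∀ {v₀ v₁ v₂ v₃ v₄ k} → InducedPath₅ v₀ v₁ v₂ v₃ v₄ → k ≤ 3 →
      ¬ Walk (toGraph T) Everything v₀ v₄ k
    InducedPath₅-far {v₀} {v₁} {v₂} {v₃} {v₄} P = far
      where
      open InducedPath₅ P
      d₀₂ : v₀ ≢ v₂
      d₀₂ = ≁-~⇒≢ v₀≁v₃ v₂~v₃
      d₀₃ : v₀ ≢ v₃
      d₀₃ = ~-≁⇒≢ v₀~v₁ (≁-sym v₁≁v₃)
      d₀₄ : v₀ ≢ v₄
      d₀₄ = ~-≁⇒≢ v₀~v₁ (≁-sym v₁≁v₄)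
      d₁₃ : v₁ ≢ v₃
      d₁₃ = ~-≁⇒≢ (~-sym v₀~v₁) (≁-sym v₀≁v₃)
      d₁₄ : v₁ ≢ v₄
      d₁₄ = ~-≁⇒≢ (~-sym v₀~v₁) (≁-sym v₀≁v₄)
      d₂₄ : v₂ ≢ v₄
      d₂₄ = ~-≁⇒≢ (~-sym v₁~v₂) (≁-sym v₁≁v₄)

      closing₃ : ∀ {w₁ w₂} → v₀ ~ w₁ → w₁ ~ w₂ → w₂ ~ v₄ → ⊥
      closing₃ {w₁} {w₂} p q r with w₁ ≟ v₁ | w₂ ≟ v₃
      ... | yes refl | _ =
        no-5-cycle v₁~v₂ v₂~v₃ v₃~v₄ (~-sym r) (~-sym q)
          d₁₃ d₁₄ d₂₄ (≁-~⇒≢ v₂≁v₄ r) (≁-~⇒≢ (≁-sym v₁≁v₃) (~-sym q))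
      ... | no w₁≢v₁ | yes refl =
        no-5-cycle v₀~v₁ v₁~v₂ v₂~v₃ (~-sym q) (~-sym p)
          d₀₂ d₀₃ d₁₃ (≢-sym w₁≢v₁) (≁-~⇒≢ (≁-sym v₀≁v₂) (~-sym p))
      ... | no w₁≢v₁ | no w₂≢v₃ =
        no-7-cycle v₀~v₁ v₁~v₂ v₂~v₃ v₃~v₄ (~-sym r) (~-sym q) (~-sym p)
          d₀₂ d₀₃ d₀₄ (≁-~⇒≢ v₀≁v₄ r) d₁₃ d₁₄ (≁-~⇒≢ v₁≁v₄ r) (≢-sym w₁≢v₁)
          d₂₄ (≁-~⇒≢ v₂≁v₄ r) (≁-~⇒≢ (≁-sym v₀≁v₂) (~-sym p))
          (≢-sym w₂≢v₃) (≁-~⇒≢ (≁-sym v₀≁v₃) (~-sym p)) (≁-~⇒≢ (≁-sym v₀≁v₄) (~-sym p))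

      far : ∀ {k} → k ≤ 3 → ¬ Walk (toGraph T) Everything v₀ v₄ k
      far _ (here _) = d₀₄ refl
      far _ (step _ p (here _)) = v₀≁v₄ p
      far _ (step _ p (step _ q (here _))) =
        no-6-cycle v₀~v₁ v₁~v₂ v₂~v₃ v₃~v₄ (~-sym q) (~-sym p)
          d₀₂ d₀₃ d₀₄ d₁₃ d₁₄ (≁-~⇒≢ v₁≁v₄ q) d₂₄ (≁-~⇒≢ v₂≁v₄ q) (≁-~⇒≢ (≁-sym v₀≁v₃) (~-sym p))
      far _ (step _ p (step _ q (step _ r (here _)))) = closing₃ p q r
      far (s≤s (s≤s (s≤s ()))) (step _ _ (step _ _ (step _ _ (step _ _ _))))

  module _ (c₁ c₂ : Fin n) where

    Leaf : Fin n → Set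
    Leaf x = x ≢ c₁ × x ≢ c₂

    leaf? : ∀ x → Dec (Leaf x)
    leaf? x = ¬? (x ≟ c₁) ×-dec ¬? (x ≟ c₂)

    Centre : Fin n → Set
    Centre x = x ≡ c₁ ⊎ x ≡ c₂

    record DoubleStar : Set where
      field
        c₁~c₂          : c₁ ~ c₂
        leaf-neighbour : ∀ {x y} → Leaf x → x ~ y → Centre y
        leaf-attached  : ∀ {x} → Leaf x → x ~ c₁ ⊎ x ~ c₂
        ~c₁⇒≁c₂        : ∀ {x} → x ~ c₁ → ¬ x ~ c₂
        a              : Fin n
        a~c₁           : a ~ c₁
        a≢c₂           : a ≢ c₂
        b              : Fin n
        b~c₂           : b ~ c₂
        b≢c₁           : b ≢ c₁

  module Diameter₃ (acyclic : ¬ Cycle (toGraph T))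
    (close : ∀ u v → ∃ λ k → k ≤ 3 × Walk (toGraph T) Everything u v k)
    {a c₁ c₂ b : Fin n} (a~c₁ : a ~ c₁) (c₁~c₂ : c₁ ~ c₂) (c₂~b : c₂ ~ b)
    (a-b-far : ∀ k → k < 3 → ¬ Walk (toGraph T) Everything a b k) where

    open Forest acyclic

    no-nonBacktracking-walk₄ : ∀ {v₀ v₁ v₂ v₃ v₄} → v₀ ~ v₁ → v₁ ~ v₂ → v₂ ~ v₃ → v₃ ~ v₄ →
      v₀ ≢ v₂ → v₁ ≢ v₃ → v₂ ≢ v₄ → ⊥
    no-nonBacktracking-walk₄ {v₀} {v₄ = v₄} p₀₁ p₁₂ p₂₃ p₃₄ d₀₂ d₁₃ d₂₄ with close v₀ v₄
    ... | _ , k≤3 , walk =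
      InducedPath₅-far (nonBacktracking⇒InducedPath₅ p₀₁ p₁₂ p₂₃ p₃₄ d₀₂ d₁₃ d₂₄) k≤3 walk

    c₁≢b : c₁ ≢ b
    c₁≢b refl = a-b-far 1 (s≤s (s≤s z≤n)) (step tt a~c₁ (here tt))

    c₂≢a : c₂ ≢ a
    c₂≢a refl = a-b-far 1 (s≤s (s≤s z≤n)) (step tt c₂~b (here tt))

    no-walk-via-c₁ : ∀ {x y} → x ~ y → y ~ c₁ → x ≢ c₁ → y ≢ c₂ → ⊥
    no-walk-via-c₁ x~y y~c₁ x≢c₁ y≢c₂ = no-nonBacktracking-walk₄ x~y y~c₁ c₁~c₂ c₂~b x≢c₁ y≢c₂ c₁≢b

    no-walk-via-c₂ : ∀ {x y} → x ~ y → y ~ c₂ → x ≢ c₂ → y ≢ c₁ → ⊥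
    no-walk-via-c₂ x~y y~c₂ x≢c₂ y≢c₁ =
      no-nonBacktracking-walk₄ x~y y~c₂ (~-sym c₁~c₂) (~-sym a~c₁) x≢c₂ y≢c₁ c₂≢a

    data NearCentre (x : Fin n) : Set where
      at-c₁      : x ≡ c₁ → NearCentre x
      at-c₂      : x ≡ c₂ → NearCentre x
      next-to-c₁ : x ~ c₁ → NearCentre x
      next-to-c₂ : x ~ c₂ → NearCentre x

    nearCentre-walk : ∀ {x k} → Walk (toGraph T) Everything x c₁ k → NearCentre x
    nearCentre-walk (here _) = at-c₁ refl
    nearCentre-walk {x} (step {w = y} _ x~y walk) with nearCentre-walk walk
    ... | at-c₁ refl = next-to-c₁ x~y
    ... | at-c₂ refl = next-to-c₂ x~y
    ... | next-to-c₁ y~c₁ with y ≟ c₂ | x ≟ c₁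
    ...   | yes refl | _        = next-to-c₂ x~y
    ...   | no _     | yes x≡c₁ = at-c₁ x≡c₁
    ...   | no y≢c₂  | no x≢c₁  = ⊥-elim (no-walk-via-c₁ x~y y~c₁ x≢c₁ y≢c₂)
    nearCentre-walk {x} (step {w = y} _ x~y walk) | next-to-c₂ y~c₂ with y ≟ c₁ | x ≟ c₂
    ...   | yes refl | _        = next-to-c₁ x~y
    ...   | no _     | yes x≡c₂ = at-c₂ x≡c₂
    ...   | no y≢c₁  | no x≢c₂  = ⊥-elim (no-walk-via-c₂ x~y y~c₂ x≢c₂ y≢c₁)

    nearCentre : ∀ x → NearCentre x
    nearCentre x = nearCentre-walk (proj₂ (proj₂ (close x c₁)))

    doubleStar : DoubleStar c₁ c₂
    doubleStar = record
      { c₁~c₂ = c₁~c₂ ; leaf-neighbour = leaf-neighbour ; leaf-attached = leaf-attached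
      ; ~c₁⇒≁c₂ = λ x~c₁ x~c₂ → no-triangle x~c₁ c₁~c₂ (~-sym x~c₂)
      ; a = a ; a~c₁ = a~c₁ ; a≢c₂ = ≢-sym c₂≢a
      ; b = b ; b~c₂ = ~-sym c₂~b ; b≢c₁ = ≢-sym c₁≢b }
      where
      leaf-neighbour : ∀ {x y} → Leaf c₁ c₂ x → x ~ y → Centre c₁ c₂ y
      leaf-neighbour {y = y} (x≢c₁ , x≢c₂) x~y with y ≟ c₁ | y ≟ c₂ | nearCentre y
      ... | yes y≡c₁ | _        | _             = inj₁ y≡c₁
      ... | no _     | yes y≡c₂ | _             = inj₂ y≡c₂
      ... | no y≢c₁  | no _     | at-c₁ y≡c₁    = ⊥-elim (y≢c₁ y≡c₁)
      ... | no _     | no y≢c₂  | at-c₂ y≡c₂    = ⊥-elim (y≢c₂ y≡c₂)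
      ... | no _     | no y≢c₂  | next-to-c₁ y~c₁ = ⊥-elim (no-walk-via-c₁ x~y y~c₁ x≢c₁ y≢c₂)
      ... | no y≢c₁  | no _     | next-to-c₂ y~c₂ = ⊥-elim (no-walk-via-c₂ x~y y~c₂ x≢c₂ y≢c₁)

      leaf-attached : ∀ {x} → Leaf c₁ c₂ x → x ~ c₁ ⊎ x ~ c₂
      leaf-attached {x} (x≢c₁ , x≢c₂) with nearCentre x
      ... | at-c₁ x≡c₁      = ⊥-elim (x≢c₁ x≡c₁)
      ... | at-c₂ x≡c₂      = ⊥-elim (x≢c₂ x≡c₂)
      ... | next-to-c₁ x~c₁ = inj₁ x~c₁
      ... | next-to-c₂ x~c₂ = inj₂ x~c₂

  tree-diameter₃⇒DoubleStar : Tree (toGraph T) → Diam (toGraph T) 3 → ∃ λ c₁ → ∃ λ c₂ → DoubleStar c₁ c₂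
  tree-diameter₃⇒DoubleStar (_ , acyclic)
    (dist≤3 , _ , _ , step _ a~c₁ (step _ c₁~c₂ (step _ c₂~b (here _))) , a-b-far) =
    _ , _ , Diameter₃.doubleStar acyclic close a~c₁ c₁~c₂ c₂~b a-b-far
    where
    close : ∀ u v → ∃ λ k → k ≤ 3 × Walk (toGraph T) Everything u v k
    close u v with dist≤3 u v
    ... | k , k≤3 , walk , _ = k , k≤3 , walk

  module MiddleOfDoubleStar {c₁ c₂ : Fin n} (S : DoubleStar c₁ c₂) where

    open DoubleStar S

    M : Graph
    M = Middle T

    _≟M_ : DecidableEquality (V M)
    _≟M_ = Sum.≡-dec _≟_ _≟E_

    c₁≢c₂ : c₁ ≢ c₂
    c₁≢c₂ = ~⇒≢ c₁~c₂

    leaf≢centre : ∀ {x c} → Leaf c₁ c₂ x → Centre c₁ c₂ c → x ≢ c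
    leaf≢centre (x≢c₁ , _) (inj₁ refl) = x≢c₁
    leaf≢centre (_ , x≢c₂) (inj₂ refl) = x≢c₂

    ¬leaf⇒centre : ∀ {x} → ¬ Leaf c₁ c₂ x → Centre c₁ c₂ x
    ¬leaf⇒centre {x} ¬leaf with x ≟ c₁ | x ≟ c₂
    ... | yes x≡c₁ | _        = inj₁ x≡c₁
    ... | no _     | yes x≡c₂ = inj₂ x≡c₂
    ... | no x≢c₁  | no x≢c₂  = ⊥-elim (¬leaf (x≢c₁ , x≢c₂))

    a-leaf : Leaf c₁ c₂ a
    a-leaf = ~⇒≢ a~c₁ , a≢c₂

    b-leaf : Leaf c₁ c₂ b
    b-leaf = b≢c₁ , ~⇒≢ b~c₂

    centre-edge : E
    centre-edge = edge c₁ c₂ c₁~c₂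

    c₁∈centre-edge : Inc c₁ centre-edge
    c₁∈centre-edge = proj₁ (edge-incident c₁ c₂ c₁~c₂)

    c₂∈centre-edge : Inc c₂ centre-edge
    c₂∈centre-edge = proj₂ (edge-incident c₁ c₂ c₁~c₂)

    leaf∉centre-edge : ∀ {x} → Leaf c₁ c₂ x → ¬ Inc x centre-edge
    leaf∉centre-edge lx x∈e =
      leaf≢centre lx (incident-ends centre-edge c₁≢c₂ c₁∈centre-edge c₂∈centre-edge x∈e) refl

    centre-ends⇒centre-edge : ∀ e → Centre c₁ c₂ (end₁ {G = T} e) → Centre c₁ c₂ (end₂ {G = T} e) →
      e ≡ centre-edge
    centre-ends⇒centre-edge e (inj₁ p) (inj₁ q) = ⊥-elim (~⇒≢ (end₁~end₂ e) (trans p (sym q)))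
    centre-ends⇒centre-edge e (inj₁ p) (inj₂ q) =
      edge-unique e centre-edge c₁≢c₂ (inj₁ (sym p)) (inj₂ (sym q)) c₁∈centre-edge c₂∈centre-edge
    centre-ends⇒centre-edge e (inj₂ p) (inj₁ q) =
      edge-unique e centre-edge c₁≢c₂ (inj₂ (sym q)) (inj₁ (sym p)) c₁∈centre-edge c₂∈centre-edge
    centre-ends⇒centre-edge e (inj₂ p) (inj₂ q) = ⊥-elim (~⇒≢ (end₁~end₂ e) (trans p (sym q)))

    edge-cases : ∀ e → (∃ λ x → Leaf c₁ c₂ x × Inc x e) ⊎ e ≡ centre-edge
    edge-cases e with leaf? c₁ c₂ (end₁ {G = T} e) | leaf? c₁ c₂ (end₂ {G = T} e)
    ... | yes leaf₁ | _         = inj₁ (_ , leaf₁ , inj₁ refl)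
    ... | no _      | yes leaf₂ = inj₁ (_ , leaf₂ , inj₂ refl)
    ... | no ¬leaf₁ | no ¬leaf₂ =
      inj₂ (centre-ends⇒centre-edge e (¬leaf⇒centre ¬leaf₁) (¬leaf⇒centre ¬leaf₂))

    -- On the centres, which have no pendant edge, the value is irrelevant.
    pendant : Fin n → E
    pendant x with x ~? c₁ | x ~? c₂
    ... | yes x~c₁ | _        = edge x c₁ x~c₁
    ... | no _     | yes x~c₂ = edge x c₂ x~c₂
    ... | no _     | no _     = centre-edge

    pendant-at-c₁ : ∀ {x} → x ~ c₁ → Inc x (pendant x) × Inc c₁ (pendant x)
    pendant-at-c₁ {x} x~c₁ with x ~? c₁
    ... | yes x~c₁′ = edge-incident x c₁ x~c₁′
    ... | no x≁c₁   = ⊥-elim (x≁c₁ x~c₁)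

    pendant-at-c₂ : ∀ {x} → x ~ c₂ → Inc x (pendant x) × Inc c₂ (pendant x)
    pendant-at-c₂ {x} x~c₂ with x ~? c₁ | x ~? c₂
    ... | yes x~c₁ | _          = ⊥-elim (~c₁⇒≁c₂ x~c₁ x~c₂)
    ... | no _     | yes x~c₂′  = edge-incident x c₂ x~c₂′
    ... | no _     | no x≁c₂    = ⊥-elim (x≁c₂ x~c₂)

    pendant-ends : ∀ {x} → Leaf c₁ c₂ x →
      ∃ λ c → Centre c₁ c₂ c × Inc x (pendant x) × Inc c (pendant x)
    pendant-ends lx with leaf-attached lx
    ... | inj₁ x~c₁ = c₁ , inj₁ refl , pendant-at-c₁ x~c₁
    ... | inj₂ x~c₂ = c₂ , inj₂ refl , pendant-at-c₂ x~c₂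

    pendant-incident : ∀ {x} → Leaf c₁ c₂ x → Inc x (pendant x)
    pendant-incident lx = proj₁ (proj₂ (proj₂ (pendant-ends lx)))

    pendant-unique : ∀ {x e} → Leaf c₁ c₂ x → Inc x e → e ≡ pendant x
    pendant-unique {x} {e} lx x∈e with other-end e x∈e
    ... | y , x~y , y∈e with leaf-neighbour lx x~y
    ...   | inj₁ refl = edge-unique e (pendant x) (~⇒≢ x~y) x∈e y∈e (proj₁ ends) (proj₂ ends)
      where ends = pendant-at-c₁ x~y
    ...   | inj₂ refl = edge-unique e (pendant x) (~⇒≢ x~y) x∈e y∈e (proj₁ ends) (proj₂ ends)
      where ends = pendant-at-c₂ x~y

    pendant-injective : ∀ {x y} → Leaf c₁ c₂ x → Leaf c₁ c₂ y → pendant x ≡ pendant y → x ≡ y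
    pendant-injective {x} lx ly px≡py with pendant-ends ly
    ... | c , centre , y∈py , c∈py
      with incident-ends (pendant _) (leaf≢centre ly centre) y∈py c∈py
             (subst (Inc x) px≡py (pendant-incident lx))
    ...   | inj₁ x≡y = x≡y
    ...   | inj₂ x≡c = ⊥-elim (leaf≢centre lx centre x≡c)

    leaves : List (Fin n)
    leaves = filter (leaf? c₁ c₂) (allFin n)

    Unique-leaves : Unique leaves
    Unique-leaves = Unique.filter⁺ (leaf? c₁ c₂) (Unique.allFin⁺ n)

    ∈-leaves⁺ : ∀ {x} → Leaf c₁ c₂ x → x ∈ leaves
    ∈-leaves⁺ {x} = ∈-filter⁺ (leaf? c₁ c₂) (∈-allFin x)

    ∈-leaves⁻ : ∀ {x} → x ∈ leaves → Leaf c₁ c₂ x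
    ∈-leaves⁻ x∈ = proj₂ (∈-filter⁻ (leaf? c₁ c₂) {xs = allFin n} x∈)

    length-leaves : suc (suc (length leaves)) ≡ n
    length-leaves = ≤-antisym
      (subst (length centres++leaves ≤_) length-allFin
        (Unique⇒length-mono-⊆ Unique-centres++leaves (λ {x} _ → ∈-allFin x)))
      (subst (_≤ length centres++leaves) length-allFin
        (Unique⇒length-mono-⊆ (Unique.allFin⁺ n) all⊆centres++leaves))
      where
      centres++leaves : List (Fin n)
      centres++leaves = c₁ ∷ c₂ ∷ leaves

      length-allFin : length (allFin n) ≡ n
      length-allFin = length-tabulate (λ i → i)

      Unique-centres++leaves : Unique centres++leaves
      Unique-centres++leaves =
        (c₁≢c₂ ∷ All.tabulate (λ x∈ → ≢-sym (proj₁ (∈-leaves⁻ x∈))))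
        ∷ All.tabulate (λ x∈ → ≢-sym (proj₂ (∈-leaves⁻ x∈))) ∷ Unique-leaves

      all⊆centres++leaves : allFin n ⊆ centres++leaves
      all⊆centres++leaves {x} _ with x ≟ c₁ | x ≟ c₂
      ... | yes refl | _        = here refl
      ... | no _     | yes refl = there (here refl)
      ... | no x≢c₁  | no x≢c₂  = there (there (∈-leaves⁺ (x≢c₁ , x≢c₂)))

    leaf-vertex pendant-edge : Fin n → V M
    leaf-vertex = inj₁
    pendant-edge x = inj₂ (pendant x)

    D₀ : List (V M)
    D₀ = map leaf-vertex leaves ++ map pendant-edge leaves

    length-D₀ : length D₀ ≡ 2 * n ∸ 4
    length-D₀ = begin
      length D₀
        ≡⟨ length-++ (map leaf-vertex leaves) ⟩
      length (map leaf-vertex leaves) + length (map pendant-edge leaves)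
        ≡⟨ cong₂ _+_ (length-map leaf-vertex leaves) (length-map pendant-edge leaves) ⟩
      length leaves + length leaves
        ≡⟨ 2ℓ≡2*[2+ℓ]∸4 (length leaves) ⟩
      2 * suc (suc (length leaves)) ∸ 4
        ≡⟨ cong (λ m → 2 * m ∸ 4) length-leaves ⟩
      2 * n ∸ 4 ∎
      where open ≡-Reasoning

    leaf∈D₀ : ∀ {x} → Leaf c₁ c₂ x → leaf-vertex x ∈ D₀
    leaf∈D₀ lx = ∈-++⁺ˡ (∈-map⁺ leaf-vertex (∈-leaves⁺ lx))

    pendant∈D₀ : ∀ {x} → Leaf c₁ c₂ x → pendant-edge x ∈ D₀
    pendant∈D₀ lx = ∈-++⁺ʳ (map leaf-vertex leaves) (∈-map⁺ pendant-edge (∈-leaves⁺ lx))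

    ∈-D₀⁻ : ∀ {s} → s ∈ D₀ →
      ∃ λ x → Leaf c₁ c₂ x × (s ≡ leaf-vertex x ⊎ s ≡ pendant-edge x)
    ∈-D₀⁻ s∈ with ∈-++⁻ (map leaf-vertex leaves) s∈
    ... | inj₁ s∈₁ with ∈-map⁻ leaf-vertex s∈₁
    ...   | x , x∈ , refl = x , ∈-leaves⁻ x∈ , inj₁ refl
    ∈-D₀⁻ s∈ | inj₂ s∈₂ with ∈-map⁻ pendant-edge s∈₂
    ...   | x , x∈ , refl = x , ∈-leaves⁻ x∈ , inj₂ refl

    Unique-D₀ : Unique D₀
    Unique-D₀ = Unique.++⁺
      (Unique.map⁺ inj₁-injective Unique-leaves)
      (Unique-map⁺-injectiveOn Unique-leaves λ x∈ y∈ px≡py →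
        pendant-injective (∈-leaves⁻ x∈) (∈-leaves⁻ y∈) (inj₂-injective px≡py))
      disjoint
      where
      disjoint : ∀ {s} → ¬ (s ∈ map leaf-vertex leaves × s ∈ map pendant-edge leaves)
      disjoint (s∈₁ , s∈₂) with ∈-map⁻ leaf-vertex s∈₁ | ∈-map⁻ pendant-edge s∈₂
      ... | _ , _ , refl | _ , _ , ()

    data Core : V M → Set where
      c₁-core          : Core (inj₁ c₁)
      c₂-core          : Core (inj₁ c₂)
      centre-edge-core : Core (inj₂ centre-edge)

    core∉D₀ : ∀ {w} → Core w → w ∉ D₀
    core∉D₀ core w∈ with ∈-D₀⁻ w∈ | core
    ... | x , lx , inj₁ refl | c₁-core          = proj₁ lx refl
    ... | x , lx , inj₁ refl | c₂-core          = proj₂ lx refl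
    ... | x , lx , inj₂ eq   | centre-edge-core =
      leaf∉centre-edge lx (subst (Inc x) (sym (inj₂-injective eq)) (pendant-incident lx))

    ∉D₀⇒core : ∀ w → w ∉ D₀ → Core w
    ∉D₀⇒core (inj₁ x) x∉ with x ≟ c₁ | x ≟ c₂
    ... | yes refl | _        = c₁-core
    ... | no _     | yes refl = c₂-core
    ... | no x≢c₁  | no x≢c₂  = ⊥-elim (x∉ (leaf∈D₀ (x≢c₁ , x≢c₂)))
    ∉D₀⇒core (inj₂ e) e∉ with edge-cases e
    ... | inj₁ (x , lx , x∈e) = ⊥-elim (e∉ (subst (λ f → inj₂ f ∈ D₀)
                                                   (sym (pendant-unique lx x∈e)) (pendant∈D₀ lx)))
    ... | inj₂ refl = centre-edge-core

    D₀-totalDominating : TotalDominating M D₀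
    D₀-totalDominating (inj₁ x) with x ≟ c₁ | x ≟ c₂
    ... | yes refl | _        = pendant-edge a , pendant∈D₀ a-leaf , proj₂ (pendant-at-c₁ a~c₁)
    ... | no _     | yes refl = pendant-edge b , pendant∈D₀ b-leaf , proj₂ (pendant-at-c₂ b~c₂)
    ... | no x≢c₁  | no x≢c₂  = pendant-edge x , pendant∈D₀ lx , pendant-incident lx
      where lx = x≢c₁ , x≢c₂
    D₀-totalDominating (inj₂ e) with edge-cases e
    ... | inj₁ (x , lx , x∈e) = leaf-vertex x , leaf∈D₀ lx , x∈e
    ... | inj₂ refl =
      pendant-edge a , pendant∈D₀ a-leaf ,
      centre-edge≢pendant-a , c₁ , c₁∈centre-edge , proj₂ (pendant-at-c₁ a~c₁)
      where
      centre-edge≢pendant-a : centre-edge ≢ pendant a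
      centre-edge≢pendant-a eq =
        leaf∉centre-edge a-leaf (subst (Inc a) (sym eq) (pendant-incident a-leaf))

    D₀-outerConnected : OuterConnected M D₀
    D₀-outerConnected u v u∉ v∉ =
      _ , walk-++ (proj₂ (to-centre-edge (∉D₀⇒core u u∉))) (proj₂ (from-centre-edge (∉D₀⇒core v v∉)))
      where
      Outside : V M → Set
      Outside w = w ∉ D₀

      centre-edge∉ : Outside (inj₂ centre-edge)
      centre-edge∉ = core∉D₀ centre-edge-core

      to-centre-edge : ∀ {w} → Core w → ∃ λ k → Walk M Outside w (inj₂ centre-edge) k
      to-centre-edge c₁-core          = _ , step (core∉D₀ c₁-core) c₁∈centre-edge (here centre-edge∉)
      to-centre-edge c₂-core          = _ , step (core∉D₀ c₂-core) c₂∈centre-edge (here centre-edge∉)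
      to-centre-edge centre-edge-core = _ , here centre-edge∉

      from-centre-edge : ∀ {w} → Core w → ∃ λ k → Walk M Outside (inj₂ centre-edge) w k
      from-centre-edge c₁-core          = _ , step centre-edge∉ c₁∈centre-edge (here (core∉D₀ c₁-core))
      from-centre-edge c₂-core          = _ , step centre-edge∉ c₂∈centre-edge (here (core∉D₀ c₂-core))
      from-centre-edge centre-edge-core = _ , here centre-edge∉

    module LowerBound (D : List (V M)) (dominating : TotalDominating M D)
      (outerConnected : OuterConnected M D) where

      open DecMembership _≟M_ using (_∈?_)

      pendant∈D : ∀ {x} → Leaf c₁ c₂ x → pendant-edge x ∈ D
      pendant∈D {x} lx with dominating (inj₁ x)
      ... | inj₂ e , e∈D , x∈e = subst (λ f → inj₂ f ∈ D) (pendant-unique lx x∈e) e∈D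

      -- The only neighbour of a leaf vertex in M(T) is its pendant edge, which lies in D.
      leaf∉D⇒everything∈ : ∀ {z} → Leaf c₁ c₂ z → leaf-vertex z ∉ D → ∀ w → w ∈ leaf-vertex z ∷ D
      leaf∉D⇒everything∈ {z} lz z∉D w with w ∈? D
      ... | yes w∈D = there w∈D
      ... | no w∉D with outerConnected (inj₁ z) w z∉D w∉D
      ...   | _ , here _ = here refl
      ...   | _ , step {w = inj₂ e} _ z∈e walk =
        ⊥-elim (walk-head walk (subst (λ f → inj₂ f ∈ D) (sym (pendant-unique lz z∈e)) (pendant∈D lz)))

      length-≥ : 2 * n ∸ 4 ≤ length D
      length-≥ with all? (λ x → leaf-vertex x ∈? D) leaves
      ... | yes leaves∈D =
        subst (_≤ length D) length-D₀
          (Unique⇒length-mono-⊆ Unique-D₀ D₀⊆D)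
        where
        D₀⊆D : D₀ ⊆ D
        D₀⊆D s∈ with ∈-D₀⁻ s∈
        ... | x , lx , inj₁ refl = All.lookup leaves∈D (∈-leaves⁺ lx)
        ... | x , lx , inj₂ refl = pendant∈D lx
      ... | no ¬leaves∈D with find (All.¬All⇒Any¬ (λ x → leaf-vertex x ∈? D) leaves ¬leaves∈D)
      ...   | z , z∈ , z∉D =
        ≤-pred (subst (_≤ suc (length D)) (cong suc length-D₀)
          (Unique⇒length-mono-⊆ (c₁∉D₀ ∷ Unique-D₀)
            (λ {w} _ → leaf∉D⇒everything∈ (∈-leaves⁻ z∈) z∉D w)))
        where
        c₁∉D₀ : All (inj₁ c₁ ≢_) D₀
        c₁∉D₀ = All.tabulate λ s∈ c₁≡s → core∉D₀ c₁-core (subst (_∈ D₀) (sym c₁≡s) s∈)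

    γtc-Middle : γtc≡ M (2 * n ∸ 4)
    γtc-Middle =
      (D₀ , (Unique-D₀ , D₀-totalDominating , D₀-outerConnected) , length-D₀)
      , λ D (_ , dominating , outerConnected) → LowerBound.length-≥ D dominating outerConnected

-- The hypothesis 4 ≤ n is implied by diam(T) = 3.
proposition3p9 : (n : ℕ) (T : FinGraph n) → 4 ≤ n → Tree (toGraph T) → Diam (toGraph T) 3 →
    γtc≡ (Middle T) (2 * n ∸ 4)
proposition3p9 n T _ tree diam₃ with tree-diameter₃⇒DoubleStar T tree diam₃
... | _ , _ , doubleStar = MiddleOfDoubleStar.γtc-Middle T doubleStar
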